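{- Let $n\ge k\ge 5$ be integers. Then there exist connected simple graphs $X$ and $Y$, each on $n$ vertices, such that $\delta(X)\ge \frac{3n}{k}-4$, $\delta(Y)\ge \frac{(k-2)n}{k}-3$, and the friends-and-strangers graph $\mathsf{FS}(X,Y)$ is disconnected.
   Context: For a simple graph $G$, $\delta(G)$ denotes its minimum degree. For two simple graphs $X$ and $Y$ with the same finite number of vertices, the friends-and-strangers graph $\mathsf{FS}(X,Y)$ has as vertex set all bijections $\sigma:V(X)\to V(Y)$; two bijections $\sigma,\tau$ are adjacent if and only if there are distinct vertices $a,b\in V(X)$ with $\{a,b\}\in E(X)$, $\{\sigma(a),\sigma(b)\}\in E(Y)$, $\tau(a)=\sigma(b)$, $\tau(b)=\sigma(a)$, and $\tau(w)=\sigma(w)$ for all $w\in V(X)\setminus\{a,b\}$. -}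

module Defs where

open import Data.Nat using (ℕ; _+_; _*_; _∸_; _≤_)
open import Data.Fin using (Fin)
open import Data.Bool using (Bool; true; false)
open import Data.Vec using (Vec; lookup)
open import Data.List using (List; length; filter)
open import Data.Fin using () renaming (_≟_ to _≟ᶠ_)
open import Data.List using () renaming (map to lmap)
open import Data.Vec.Functional using () 
open import Data.List.Base using ()
open import Data.Fin.Base using ()
open import Data.Product using (Σ; ∃; _×_; _,_)
open import Relation.Nullary using (¬_)
open import Relation.Binary.PropositionalEquality using (_≡_)
open import Relation.Binary.Construct.Closure.ReflexiveTransitive using (Star)
open import Function.Definitions using (Injective)
open import Data.Bool using (T)
open import Data.List using (allFin)
open import Relation.Nullary.Decidable using (Dec)
import Data.Bool.Properties as BP

record SimpleGraph (n : ℕ) : Set where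
  field
    adj   : Fin n → Fin n → Bool
    sym   : ∀ u v → adj u v ≡ adj v u
    irrefl : ∀ v → adj v v ≡ false
open SimpleGraph public

Edge : ∀ {n} → SimpleGraph n → Fin n → Fin n → Set
Edge G u v = T (adj G u v)

degree : ∀ {n} → SimpleGraph n → Fin n → ℕ
degree {n} G v = length (filter (λ u → BP.T? (adj G v u)) (allFin n))

Connected : ∀ {n} → SimpleGraph n → Set
Connected {n} G = ∀ (u v : Fin n) → Star (Edge G) u v

-- Bijections V(X) = Fin n → V(Y) = Fin n, represented as vectors
-- (so that equality is extensional); a bijection is an injective map
-- Fin n → Fin n (equivalently bijective, as the set is finite).
IsBij : ∀ {n} → Vec (Fin n) n → Set
IsBij σ = Injective _≡_ _≡_ (lookup σ)

FSVertex : ℕ → Set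
FSVertex n = Σ (Vec (Fin n) n) IsBij

FSAdj : ∀ {n} → SimpleGraph n → SimpleGraph n → FSVertex n → FSVertex n → Set
FSAdj {n} X Y (σ , _) (τ , _) =
  ∃ λ (a : Fin n) → ∃ λ (b : Fin n) →
    ¬ (a ≡ b) × Edge X a b × Edge Y (lookup σ a) (lookup σ b) ×
    lookup τ a ≡ lookup σ b × lookup τ b ≡ lookup σ a ×
    (∀ w → ¬ (w ≡ a) → ¬ (w ≡ b) → lookup τ w ≡ lookup σ w)

FSConnected : ∀ {n} → SimpleGraph n → SimpleGraph n → Set
FSConnected {n} X Y = ∀ (σ τ : FSVertex n) → Star (FSAdj X Y) σ τ

-- Put vertex i of {0, …, n − 1} into residue class i mod k and arrange the
-- classes on the cycle C_k.  X joins two vertices whose classes are equal or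
-- adjacent on the cycle, Y joins two vertices whose classes are not adjacent.
-- An FS-move swaps the labels across an X-edge ab whose labels span a Y-edge;
-- if the bijection is class-preserving, the classes of a and b are equal or
-- adjacent (X-edge) but not adjacent (Y-edge), hence equal, so the result is
-- class-preserving again.  The identity is class-preserving and the
-- transposition of 0 and 1 is not, so FS(X, Y) is disconnected.  Every class
-- has ⌊n/k⌋ or ⌈n/k⌉ elements; a vertex of X sees all other vertices of three
-- classes and a vertex of Y all vertices outside two classes, which gives the
-- degree bounds.  X contains the path 0, 1, …, n − 1, and in Y vertex 0
-- reaches every vertex in at most two steps.

module Submission where

open import Data.Bool using (Bool; true; false; T; not; _∧_; _∨_; if_then_else_)
open import Data.Bool.Properties using (T?; T-∧; T-∨; T-≡; T-not-≡; ∨-comm)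
open import Data.Empty using (⊥; ⊥-elim)
open import Data.Fin using (Fin; zero; suc; toℕ; inject₁) renaming (_≟_ to _≟ᶠ_)
open import Data.Fin.Induction using (<-weakInduction)
open import Data.Fin.Permutation using (Permutation′; _⟨$⟩ʳ_; transpose) renaming (id to idₚ)
open import Data.Fin.Properties using (toℕ-inject₁; toℕ-injective)
open import Data.List using (length; filter; tabulate)
open import Data.Nat
open import Data.Nat.DivMod
open import Data.Nat.Properties
open import Data.Nat.Tactic.RingSolver using (solve-∀)
open import Data.Product using (Σ; _×_; _,_; proj₂)
open import Data.Sum using (_⊎_; inj₁; inj₂)
open import Data.Unit using (tt)
open import Data.Vec using (lookup) renaming (tabulate to tabulateᵛ)
open import Data.Vec.Properties using (lookup∘tabulate)
open import Defs hiding (sym)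
open import Function using (_∘_; Equivalence; Injection)
open import Function.Definitions using (Injective)
open import Function.Properties.Inverse using (↔⇒↣)
open import Relation.Binary.Construct.Closure.ReflexiveTransitive using (Star; ε; _◅_; _◅◅_; reverse)
open import Relation.Binary.PropositionalEquality
open import Relation.Nullary using (¬_; yes; no)
open import Relation.Nullary.Decidable using (dec-true; dec-false)

T-ext : ∀ {x y} → (T x → T y) → (T y → T x) → x ≡ y
T-ext {false} {false} _   _   = refl
T-ext {false} {true}  _   y⇒x = ⊥-elim (y⇒x tt)
T-ext {true}  {false} x⇒y _   = ⊥-elim (x⇒y tt)
T-ext {true}  {true}  _   _   = refl

≡ᵇ-cong : ∀ {m n m′ n′} → (m ≡ n → m′ ≡ n′) → (m′ ≡ n′ → m ≡ n) → (m ≡ᵇ n) ≡ (m′ ≡ᵇ n′)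
≡ᵇ-cong {m} {n} {m′} {n′} to from =
  T-ext (≡⇒≡ᵇ m′ n′ ∘ to ∘ ≡ᵇ⇒≡ m n) (≡⇒≡ᵇ m n ∘ from ∘ ≡ᵇ⇒≡ m′ n′)

≡ᵇ-sym : ∀ m n → (m ≡ᵇ n) ≡ (n ≡ᵇ m)
≡ᵇ-sym m n = ≡ᵇ-cong {m} {n} {n} {m} sym sym

count : ℕ → (ℕ → Bool) → ℕ
count zero    p = 0
count (suc n) p = if p 0 then suc (count n (p ∘ suc)) else count n (p ∘ suc)

length-filter-tabulate : ∀ {A : Set} n (f : Fin n → A) (p : A → Bool) {q : ℕ → Bool} →
  (∀ i → p (f i) ≡ q (toℕ i)) → length (filter (T? ∘ p) (tabulate f)) ≡ count n q
length-filter-tabulate zero    f p pq = refl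
length-filter-tabulate (suc n) f p {q} pq
  rewrite pq zero with q 0
... | true  = cong suc (length-filter-tabulate n (f ∘ suc) p (pq ∘ suc))
... | false = length-filter-tabulate n (f ∘ suc) p (pq ∘ suc)

count-≤ : ∀ n p → count n p ≤ n
count-≤ zero    p = z≤n
count-≤ (suc n) p with p 0
... | true  = s≤s (count-≤ n (p ∘ suc))
... | false = m≤n⇒m≤1+n (count-≤ n (p ∘ suc))

count-none : ∀ n p → (∀ i → ¬ T (p i)) → count n p ≡ 0
count-none zero    p none = refl
count-none (suc n) p none with p 0 | none 0
... | true  | ¬p0 = ⊥-elim (¬p0 tt)
... | false | _   = count-none n (p ∘ suc) (none ∘ suc)

count-mono : ∀ n {p q} → (∀ {i} → i < n → T (p i) → T (q i)) → count n p ≤ count n q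
count-mono zero    p⇒q = z≤n
count-mono (suc n) {p} {q} p⇒q with p 0 | q 0 | p⇒q {0} z<s
... | true  | true  | _   = s≤s (count-mono n (p⇒q ∘ s<s))
... | true  | false | p0⇒ = ⊥-elim (p0⇒ tt)
... | false | true  | _   = m≤n⇒m≤1+n (count-mono n (p⇒q ∘ s<s))
... | false | false | _   = count-mono n (p⇒q ∘ s<s)

count-cong : ∀ n {p q} → (∀ {i} → i < n → p i ≡ q i) → count n p ≡ count n q
count-cong zero    p≡q = refl
count-cong (suc n) {p} {q} p≡q rewrite p≡q {0} z<s =
  cong (λ m → if q 0 then suc m else m) (count-cong n (p≡q ∘ s<s))

count-+ : ∀ m n p → count (m + n) p ≡ count m p + count n (λ i → p (m + i))
count-+ zero    n p = refl
count-+ (suc m) n p with p 0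
... | true  = cong suc (count-+ m n (p ∘ suc))
... | false = count-+ m n (p ∘ suc)

count-∨+count-∧ : ∀ n p q →
  count n (λ i → p i ∨ q i) + count n (λ i → p i ∧ q i) ≡ count n p + count n q
count-∨+count-∧ zero    p q = refl
count-∨+count-∧ (suc n) p q with p 0 | q 0 | count-∨+count-∧ n (p ∘ suc) (q ∘ suc)
... | true  | true  | ih = cong suc (trans (+-suc _ _) (trans (cong suc ih) (sym (+-suc _ _))))
... | true  | false | ih = cong suc ih
... | false | true  | ih = trans (cong suc ih) (sym (+-suc _ _))
... | false | false | ih = ih

count-∨-≤ : ∀ n p q → count n (λ i → p i ∨ q i) ≤ count n p + count n q
count-∨-≤ n p q = ≤-trans (m≤m+n _ _) (≤-reflexive (count-∨+count-∧ n p q))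

count-∨-disjoint : ∀ n p q → (∀ i → T (p i) → T (q i) → ⊥) →
  count n (λ i → p i ∨ q i) ≡ count n p + count n q
count-∨-disjoint n p q disjoint = begin
  count n (λ i → p i ∨ q i)                                 ≡⟨ +-identityʳ _ ⟨
  count n (λ i → p i ∨ q i) + 0
    ≡⟨ cong (count n (λ i → p i ∨ q i) +_) (count-none n _ never-both) ⟨
  count n (λ i → p i ∨ q i) + count n (λ i → p i ∧ q i)     ≡⟨ count-∨+count-∧ n p q ⟩
  count n p + count n q                                     ∎
  where
  open ≡-Reasoning
  never-both : ∀ i → ¬ T (p i ∧ q i)
  never-both i both = let (pi , qi) = Equivalence.to T-∧ both in disjoint i pi qi

count-≡ᵇ-≤1 : ∀ n c → count n (c ≡ᵇ_) ≤ 1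
count-≡ᵇ-≤1 zero    c       = z≤n
count-≡ᵇ-≤1 (suc n) zero    = s≤s (≤-reflexive (count-none n _ λ _ ()))
count-≡ᵇ-≤1 (suc n) (suc c) = count-≡ᵇ-≤1 n c

count-≡ᵇ : ∀ {n c} → c < n → count n (c ≡ᵇ_) ≡ 1
count-≡ᵇ {suc n} {zero}  _   = cong suc (count-none n _ λ _ ())
count-≡ᵇ {suc n} {suc c} c<n = count-≡ᵇ (s<s⁻¹ c<n)

count-not : ∀ n p → count n p + count n (not ∘ p) ≡ n
count-not zero    p = refl
count-not (suc n) p with p 0
... | true  = cong suc (count-not n (p ∘ suc))
... | false = trans (+-suc _ _) (cong suc (count-not n (p ∘ suc)))

count-delete-≤ : ∀ n x p → count n p ≤ count n (λ y → not (x ≡ᵇ y) ∧ p y) + 1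
count-delete-≤ n x p = begin
  count n p                                                   ≤⟨ count-mono n (λ _ → kept-or-deleted (x ≡ᵇ _)) ⟩
  count n (λ y → (not (x ≡ᵇ y) ∧ p y) ∨ (x ≡ᵇ y))             ≤⟨ count-∨-≤ n _ _ ⟩
  count n (λ y → not (x ≡ᵇ y) ∧ p y) + count n (x ≡ᵇ_)        ≤⟨ +-monoʳ-≤ _ (count-≡ᵇ-≤1 n x) ⟩
  count n (λ y → not (x ≡ᵇ y) ∧ p y) + 1                      ∎
  where
  open ≤-Reasoning
  kept-or-deleted : ∀ e {b} → T b → T ((not e ∧ b) ∨ e)
  kept-or-deleted true           _ = tt
  kept-or-deleted false {true}   _ = tt

three-classes-bound : ∀ {k n d A B C} → n < k * suc A → n < k * suc B → n < k * suc C →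
  A + (B + C) ≤ d + 1 → 3 * n ≤ k * d + 4 * k
three-classes-bound {k} {n} {d} {A} {B} {C} nA nB nC ABC≤ = begin
  3 * n                                         ≤⟨ *-monoʳ-≤ 3 (n≤1+n n) ⟩
  suc n + (suc n + (suc n + 0))                 ≤⟨ +-mono-≤ nA (+-mono-≤ nB (+-monoˡ-≤ 0 nC)) ⟩
  k * suc A + (k * suc B + (k * suc C + 0))     ≡⟨ collect k A B C ⟩
  k * (A + (B + C)) + 3 * k                     ≤⟨ +-monoˡ-≤ (3 * k) (*-monoʳ-≤ k ABC≤) ⟩
  k * (d + 1) + 3 * k                           ≡⟨ expand k d ⟩
  k * d + 4 * k                                 ∎
  where
  open ≤-Reasoning
  collect : ∀ k A B C → k * suc A + (k * suc B + (k * suc C + 0)) ≡ k * (A + (B + C)) + 3 * k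
  collect = solve-∀
  expand : ∀ k d → k * (d + 1) + 3 * k ≡ k * d + 4 * k
  expand = solve-∀

two-classes-bound : ∀ {k n d B C} → k * B < n + k → k * C < n + k →
  n ≤ B + C + (d + 1) → (k ∸ 2) * n ≤ k * d + 3 * k
two-classes-bound {zero}        _  _  _ = z≤n
two-classes-bound {suc zero}    _  _  _ = z≤n
two-classes-bound {k@(suc (suc j))} {n} {d} {B} {C} kB kC n≤ = +-cancelʳ-≤ (2 * n) _ _ (begin
  j * n + 2 * n                          ≡⟨ merge j n ⟩
  k * n                                  ≤⟨ *-monoʳ-≤ k n≤ ⟩
  k * (B + C + (d + 1))                  ≡⟨ *-distribˡ-+ k (B + C) (d + 1) ⟩
  k * (B + C) + k * (d + 1)              ≡⟨ cong (_+ k * (d + 1)) (*-distribˡ-+ k B C) ⟩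
  k * B + k * C + k * (d + 1)            ≤⟨ +-monoˡ-≤ (k * (d + 1)) (+-mono-≤ (<⇒≤ kB) (<⇒≤ kC)) ⟩
  (n + k) + (n + k) + k * (d + 1)        ≡⟨ rearrange k n d ⟩
  k * d + 3 * k + 2 * n                  ∎)
  where
  open ≤-Reasoning
  merge : ∀ j n → j * n + 2 * n ≡ (2 + j) * n
  merge = solve-∀
  rearrange : ∀ k n d → (n + k) + (n + k) + k * (d + 1) ≡ k * d + 3 * k + 2 * n
  rearrange = solve-∀

module Residues (k : ℕ) .{{_ : NonZero k}} where

  classSize : ℕ → ℕ → ℕ
  classSize n c = count n (λ i → c ≡ᵇ i % k)

  classSize-k+ : ∀ {c} m → c < k → classSize (k + m) c ≡ suc (classSize m c)
  classSize-k+ {c} m c<k = begin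
    classSize (k + m) c                                          ≡⟨ count-+ k m _ ⟩
    count k (λ i → c ≡ᵇ i % k) + count m (λ i → c ≡ᵇ (k + i) % k) ≡⟨ cong₂ _+_ first-block shifted ⟩
    1 + classSize m c                                            ∎
    where
    open ≡-Reasoning
    first-block : count k (λ i → c ≡ᵇ i % k) ≡ 1
    first-block = trans (count-cong k (λ i<k → cong (c ≡ᵇ_) (m<n⇒m%n≡m i<k))) (count-≡ᵇ c<k)
    shifted : count m (λ i → c ≡ᵇ (k + i) % k) ≡ classSize m c
    shifted = count-cong m λ {i} _ → cong (c ≡ᵇ_) (trans (cong (_% k) (+-comm k i)) ([m+n]%n≡m%n i k))

  classSize-*+ : ∀ {c} q r → c < k → classSize (q * k + r) c ≡ q + classSize r c
  classSize-*+ zero    r c<k = refl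
  classSize-*+ {c} (suc q) r c<k = begin
    classSize ((k + q * k) + r) c ≡⟨ cong (λ m → classSize m c) (+-assoc k (q * k) r) ⟩
    classSize (k + (q * k + r)) c ≡⟨ classSize-k+ (q * k + r) c<k ⟩
    suc (classSize (q * k + r) c) ≡⟨ cong suc (classSize-*+ q r c<k) ⟩
    suc q + classSize r c         ∎
    where open ≡-Reasoning

  classSize-div-mod : ∀ {c} n → c < k → classSize n c ≡ n / k + classSize (n % k) c
  classSize-div-mod {c} n c<k = begin
    classSize n c                           ≡⟨ cong (λ m → classSize m c) (trans (m≡m%n+[m/n]*n n k) (+-comm (n % k) _)) ⟩
    classSize (n / k * k + n % k) c         ≡⟨ classSize-*+ (n / k) (n % k) c<k ⟩
    n / k + classSize (n % k) c             ∎
    where open ≡-Reasoning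

  classSize≤1 : ∀ {c r} → r < k → classSize r c ≤ 1
  classSize≤1 {c} {r} r<k = begin
    classSize r c          ≡⟨ count-cong r (λ i<r → cong (c ≡ᵇ_) (m<n⇒m%n≡m (<-trans i<r r<k))) ⟩
    count r (c ≡ᵇ_)        ≤⟨ count-≡ᵇ-≤1 r c ⟩
    1                      ∎
    where open ≤-Reasoning

  classSize-lower : ∀ {c} n → c < k → n < k * suc (classSize n c)
  classSize-lower {c} n c<k = begin-strict
    n                             ≡⟨ m≡m%n+[m/n]*n n k ⟩
    n % k + n / k * k             <⟨ +-monoˡ-< (n / k * k) (m%n<n n k) ⟩
    k + n / k * k                 ≡⟨ *-comm (suc (n / k)) k ⟩
    k * suc (n / k)               ≤⟨ *-monoʳ-≤ k (s≤s (m≤m+n (n / k) _)) ⟩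
    k * suc (n / k + classSize (n % k) c) ≡⟨ cong (λ m → k * suc m) (classSize-div-mod n c<k) ⟨
    k * suc (classSize n c)       ∎
    where open ≤-Reasoning

  classSize-upper : ∀ {c} n → c < k → k * classSize n c < n + k
  classSize-upper {c} n c<k = begin-strict
    k * classSize n c                        ≡⟨ cong (k *_) (classSize-div-mod n c<k) ⟩
    k * (n / k + t)                          ≡⟨ *-distribˡ-+ k (n / k) t ⟩
    k * (n / k) + k * t
      <⟨ +-monoʳ-< (k * (n / k)) (remainder-block (classSize≤1 {c} (m%n<n n k)) (count-≤ (n % k) _)) ⟩
    k * (n / k) + (n % k + k)                ≡⟨ +-assoc (k * (n / k)) (n % k) k ⟨
    k * (n / k) + n % k + k
      ≡⟨ cong (_+ k) (trans (+-comm _ (n % k)) (cong (n % k +_) (*-comm k (n / k)))) ⟩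
    n % k + n / k * k + k                    ≡⟨ cong (_+ k) (m≡m%n+[m/n]*n n k) ⟨
    n + k                                    ∎
    where
    open ≤-Reasoning
    t = classSize (n % k) c
    remainder-block : ∀ {t r} → t ≤ 1 → t ≤ r → k * t < r + k
    remainder-block {r = r} z≤n _ rewrite *-zeroʳ k = ≤-trans (>-nonZero⁻¹ k) (m≤n+m k r)
    remainder-block (s≤s z≤n) 1≤r rewrite *-identityʳ k = m<n+m k 1≤r

  next : ℕ → ℕ
  next a = suc a % k

  prev : ℕ → ℕ
  prev zero    = pred k
  prev (suc a) = a

  next-% : ∀ m → next (m % k) ≡ suc m % k
  next-% m = begin
    suc (m % k) % k                  ≡⟨ %-distribˡ-+ 1 (m % k) k ⟩
    (1 % k + m % k % k) % k          ≡⟨ cong (λ j → (1 % k + j) % k) (m%n%n≡m%n m k) ⟩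
    (1 % k + m % k) % k              ≡⟨ %-distribˡ-+ 1 m k ⟨
    suc m % k                        ∎
    where open ≡-Reasoning

  next-cases : ∀ {a} → a < k → (suc a < k × next a ≡ suc a) ⊎ (suc a ≡ k × next a ≡ 0)
  next-cases a<k with m≤n⇒m<n∨m≡n a<k
  ... | inj₁ 1+a<k = inj₁ (1+a<k , m<n⇒m%n≡m 1+a<k)
  ... | inj₂ 1+a≡k = inj₂ (1+a≡k , trans (cong (_% k) 1+a≡k) (n%n≡0 k))

  next-< : ∀ a → next a < k
  next-< a = m%n<n (suc a) k

  prev-< : ∀ {a} → a < k → prev a < k
  prev-< {zero}  _   = ≤-reflexive (suc-pred k)
  prev-< {suc a} a<k = <-trans (n<1+n a) a<k

  next-prev : ∀ {a} → a < k → next (prev a) ≡ a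
  next-prev {zero}  _   = trans (cong (_% k) (suc-pred k)) (n%n≡0 k)
  next-prev {suc a} a<k = m<n⇒m%n≡m a<k

  prev-next : ∀ {b} → b < k → prev (next b) ≡ b
  prev-next b<k with next-cases b<k
  ... | inj₁ (_ , next≡) = cong prev next≡
  ... | inj₂ (1+b≡k , next≡) = trans (cong prev next≡) (cong pred (sym 1+b≡k))

  next-≢ : 2 ≤ k → ∀ {a} → a < k → a ≢ next a
  next-≢ 2≤k a<k a≡next with next-cases a<k
  ... | inj₁ (_ , next≡) = 1+n≢n (sym (trans a≡next next≡))
  ... | inj₂ (1+a≡k , next≡) = <-irrefl 1+a≡k (subst (λ a → suc a < k) (sym (trans a≡next next≡)) 2≤k)

  next-next-≢ : 3 ≤ k → ∀ {a} → a < k → a ≢ next (next a)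
  next-next-≢ 3≤k {a} a<k a≡next² with next-cases a<k
  ... | inj₂ (1+a≡k , next≡) = <-irrefl 1+a≡k (subst (λ a → suc a < k) (sym a≡1) 3≤k)
    where
    a≡1 : a ≡ 1
    a≡1 = trans a≡next² (trans (cong next next≡) (m<n⇒m%n≡m (≤-trans (s≤s (s≤s z≤n)) 3≤k)))
  ... | inj₁ (1+a<k , next≡) with next-cases 1+a<k
  ...   | inj₁ (_ , next≡′) =
    <-irrefl (trans a≡next² (trans (cong next next≡) next≡′)) (<-trans (n<1+n a) (n<1+n (suc a)))
  ...   | inj₂ (2+a≡k , next≡′) =
    <-irrefl 2+a≡k (subst (λ a → suc (suc a) < k) (sym (trans a≡next² (trans (cong next next≡) next≡′))) 3≤k)

  cycleAdj : ℕ → ℕ → Bool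
  cycleAdj a b = (next a ≡ᵇ b) ∨ (a ≡ᵇ next b)

  cycleClose : ℕ → ℕ → Bool
  cycleClose a b = (a ≡ᵇ b) ∨ cycleAdj a b

  cycleAdj-sym : ∀ a b → cycleAdj a b ≡ cycleAdj b a
  cycleAdj-sym a b = trans (∨-comm (next a ≡ᵇ b) _) (cong₂ _∨_ (≡ᵇ-sym a (next b)) (≡ᵇ-sym (next a) b))

  cycleClose-sym : ∀ a b → cycleClose a b ≡ cycleClose b a
  cycleClose-sym a b = cong₂ _∨_ (≡ᵇ-sym a b) (cycleAdj-sym a b)

  count-cycleAdj : 3 ≤ k → ∀ n {a} → a < k →
    count n (λ y → cycleAdj a (y % k)) ≡ classSize n (next a) + classSize n (prev a)
  count-cycleAdj 3≤k n {a} a<k = begin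
    count n (λ y → cycleAdj a (y % k))                                 ≡⟨ count-∨-disjoint n _ _ not-both ⟩
    classSize n (next a) + count n (λ y → a ≡ᵇ next (y % k))
      ≡⟨ cong (classSize n (next a) +_) (count-cong n λ {y} _ → predecessors y) ⟩
    classSize n (next a) + classSize n (prev a)                        ∎
    where
    open ≡-Reasoning
    not-both : ∀ y → T (next a ≡ᵇ y % k) → T (a ≡ᵇ next (y % k)) → ⊥
    not-both y t t′ = next-next-≢ 3≤k a<k (trans (≡ᵇ⇒≡ _ _ t′) (cong next (sym (≡ᵇ⇒≡ _ _ t))))
    predecessors : ∀ y → (a ≡ᵇ next (y % k)) ≡ (prev a ≡ᵇ y % k)
    predecessors y = ≡ᵇ-cong (λ a≡ → trans (cong prev a≡) (prev-next (m%n<n y k)))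
                             (λ prev≡ → trans (sym (next-prev a<k)) (cong next prev≡))

  count-cycleClose : 3 ≤ k → ∀ n {a} → a < k →
    count n (λ y → cycleClose a (y % k)) ≡ classSize n a + (classSize n (next a) + classSize n (prev a))
  count-cycleClose 3≤k n {a} a<k =
    trans (count-∨-disjoint n _ _ not-both) (cong (classSize n a +_) (count-cycleAdj 3≤k n a<k))
    where
    not-both : ∀ y → T (a ≡ᵇ y % k) → T (cycleAdj a (y % k)) → ⊥
    not-both y t t′ with Equivalence.to T-∨ (subst (T ∘ cycleAdj a) (sym (≡ᵇ⇒≡ _ _ t)) t′)
    ... | inj₁ next≡a = next-≢ (<⇒≤ 3≤k) a<k (sym (≡ᵇ⇒≡ _ _ next≡a))
    ... | inj₂ a≡next = next-≢ (<⇒≤ 3≤k) a<k (≡ᵇ⇒≡ _ _ a≡next)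

  cycleClose-next : ∀ a → T (cycleClose a (next a))
  cycleClose-next a = Equivalence.from (T-∨ {a ≡ᵇ next a})
    (inj₂ (Equivalence.from (T-∨ {next a ≡ᵇ next a}) (inj₁ (≡⇒≡ᵇ (next a) (next a) refl))))

module Loopless (R : ℕ → ℕ → Bool) (R-sym : ∀ x y → R x y ≡ R y x) {n : ℕ} where

  graph : SimpleGraph n
  graph = record
    { adj    = λ u v → not (toℕ u ≡ᵇ toℕ v) ∧ R (toℕ u) (toℕ v)
    ; sym    = λ u v → cong₂ (λ e r → not e ∧ r) (≡ᵇ-sym (toℕ u) (toℕ v)) (R-sym (toℕ u) (toℕ v))
    ; irrefl = λ v → cong (λ e → not e ∧ R (toℕ v) (toℕ v)) (Equivalence.to T-≡ (≡⇒≡ᵇ (toℕ v) (toℕ v) refl))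
    }

  edge : ∀ {u v : Fin n} → toℕ u ≢ toℕ v → T (R (toℕ u) (toℕ v)) → Edge graph u v
  edge {u} {v} u≢v r = Equivalence.from T-∧ (Equivalence.from T-not-≡ (dec-false (toℕ u ≟ toℕ v) u≢v) , r)

  edge⁻ : ∀ {u v : Fin n} → Edge graph u v → T (R (toℕ u) (toℕ v))
  edge⁻ e = proj₂ (Equivalence.to T-∧ e)

  degree≡count : ∀ v → degree graph v ≡ count n (λ y → not (toℕ v ≡ᵇ y) ∧ R (toℕ v) y)
  degree≡count v = length-filter-tabulate n (λ u → u) (adj graph v) (λ _ → refl)

Edge-sym : ∀ {n} (G : SimpleGraph n) {u v} → Edge G u v → Edge G v u
Edge-sym G {u} {v} = subst T (SimpleGraph.sym G u v)

connected-from : ∀ {n} (G : SimpleGraph n) (z : Fin n) → (∀ v → Star (Edge G) z v) → Connected G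
connected-from G z reach u v = reverse (Edge-sym G) (reach u) ◅◅ reach v

connected-if-consecutive : ∀ {m} (G : SimpleGraph (suc m)) → (∀ i → Edge G (inject₁ i) (suc i)) → Connected G
connected-if-consecutive G consecutive = connected-from G zero
  (<-weakInduction (Star (Edge G) zero) ε (λ i reach-i → reach-i ◅◅ consecutive i ◅ ε))

Preserves : ∀ {n} {C : Set} → (Fin n → C) → FSVertex n → Set
Preserves f (σ , _) = ∀ x → f (lookup σ x) ≡ f x

tabulate-IsBij : ∀ {n} {f : Fin n → Fin n} → Injective _≡_ _≡_ f → IsBij (tabulateᵛ f)
tabulate-IsBij {f = f} f-injective {i} {j} fi≡fj =
  f-injective (trans (sym (lookup∘tabulate f i)) (trans fi≡fj (lookup∘tabulate f j)))

permutationVertex : ∀ {n} → Permutation′ n → FSVertex n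
permutationVertex π = tabulateᵛ (π ⟨$⟩ʳ_) , tabulate-IsBij (Injection.injective (↔⇒↣ π))

module _ {n} (X Y : SimpleGraph n) {C : Set} (f : Fin n → C) (R : C → C → Set)
  (X-edge : ∀ {u v} → Edge X u v → f u ≡ f v ⊎ R (f u) (f v))
  (Y-edge : ∀ {u v} → Edge Y u v → ¬ R (f u) (f v)) where

  FSAdj-preserves : ∀ {σ τ} → FSAdj X Y σ τ → Preserves f σ → Preserves f τ
  FSAdj-preserves {σ , _} {τ , _} (a , b , _ , eX , eY , τa≡σb , τb≡σa , τ-elsewhere) σ-pres = τ-pres
    where
    fa≡fb : f a ≡ f b
    fa≡fb with X-edge eX
    ... | inj₁ fa≡fb = fa≡fb
    ... | inj₂ r     = ⊥-elim (Y-edge eY (subst₂ R (sym (σ-pres a)) (sym (σ-pres b)) r))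
    τ-pres : ∀ w → f (lookup τ w) ≡ f w
    τ-pres w with w ≟ᶠ a | w ≟ᶠ b
    ... | yes refl | _        = trans (cong f τa≡σb) (trans (σ-pres b) (sym fa≡fb))
    ... | no _     | yes refl = trans (cong f τb≡σa) (trans (σ-pres a) fa≡fb)
    ... | no w≢a   | no w≢b   = trans (cong f (τ-elsewhere w w≢a w≢b)) (σ-pres w)

  Star-preserves : ∀ {σ τ} → Star (FSAdj X Y) σ τ → Preserves f σ → Preserves f τ
  Star-preserves ε                         = λ σ-pres → σ-pres
  Star-preserves {σ} (_◅_ {j = ρ} step path) = Star-preserves path ∘ FSAdj-preserves {σ} {ρ} step

  ¬FSConnected-if-classes-differ : ∀ u v → f u ≢ f v → ¬ FSConnected X Y
  ¬FSConnected-if-classes-differ u v fu≢fv connected =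
    fu≢fv (trans (sym (Star-preserves (connected (permutationVertex idₚ) swap) id-preserves u)) (cong f swap-u))
    where
    swap = permutationVertex (transpose u v)
    swap-u : lookup (tabulateᵛ (transpose u v ⟨$⟩ʳ_)) u ≡ v
    swap-u rewrite lookup∘tabulate (transpose u v ⟨$⟩ʳ_) u | dec-true (u ≟ᶠ u) refl = refl
    id-preserves : Preserves f (permutationVertex idₚ)
    id-preserves x = cong f (lookup∘tabulate _ x)

module Construction (k : ℕ) .{{_ : NonZero k}} where
  open Residues k

  class : ∀ {n} → Fin n → ℕ
  class v = toℕ v % k

  module X = Loopless (λ x y → cycleClose (x % k) (y % k)) (λ x y → cycleClose-sym (x % k) (y % k))
  module Y = Loopless (λ x y → not (cycleAdj (x % k) (y % k))) (λ x y → cong not (cycleAdj-sym (x % k) (y % k)))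

  X : ∀ n → SimpleGraph n
  X n = X.graph

  Y : ∀ n → SimpleGraph n
  Y n = Y.graph

  X-edge : ∀ {n} {u v : Fin n} → Edge (X n) u v → class u ≡ class v ⊎ T (cycleAdj (class u) (class v))
  X-edge e with Equivalence.to T-∨ (X.edge⁻ e)
  ... | inj₁ same = inj₁ (≡ᵇ⇒≡ _ _ same)
  ... | inj₂ adj  = inj₂ adj

  Y-edge : ∀ {n} {u v : Fin n} → Edge (Y n) u v → ¬ T (cycleAdj (class u) (class v))
  Y-edge e adj = subst T (Equivalence.to T-not-≡ (Y.edge⁻ e)) adj

  ¬FSConnected-XY : 2 ≤ k → ∀ m → ¬ FSConnected (X (2 + m)) (Y (2 + m))
  ¬FSConnected-XY 2≤k m =
    ¬FSConnected-if-classes-differ (X (2 + m)) (Y (2 + m)) class (λ a b → T (cycleAdj a b)) X-edge Y-edge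
      zero (suc zero) (λ 0≡1 → 0≢1+n (trans (sym (m<n⇒m%n≡m (>-nonZero⁻¹ k))) (trans 0≡1 (m<n⇒m%n≡m 2≤k))))

  X-degree : 3 ≤ k → ∀ n (v : Fin n) → 3 * n ≤ k * degree (X n) v + 4 * k
  X-degree 3≤k n v =
    three-classes-bound {k} {n} {degree (X n) v} {classSize n a} {classSize n (next a)} {classSize n (prev a)}
      (classSize-lower n a<k) (classSize-lower n (next-< a)) (classSize-lower n (prev-< a<k)) classes≤degree
    where
    open ≤-Reasoning
    a = class v
    a<k = m%n<n (toℕ v) k
    classes≤degree : classSize n a + (classSize n (next a) + classSize n (prev a)) ≤ degree (X n) v + 1
    classes≤degree = begin
      classSize n a + (classSize n (next a) + classSize n (prev a))  ≡⟨ count-cycleClose 3≤k n a<k ⟨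
      count n (λ y → cycleClose a (y % k))                           ≤⟨ count-delete-≤ n (toℕ v) _ ⟩
      count n (λ y → not (toℕ v ≡ᵇ y) ∧ cycleClose a (y % k)) + 1    ≡⟨ cong (_+ 1) (X.degree≡count v) ⟨
      degree (X n) v + 1                                             ∎

  Y-degree : 3 ≤ k → ∀ n (v : Fin n) → (k ∸ 2) * n ≤ k * degree (Y n) v + 3 * k
  Y-degree 3≤k n v =
    two-classes-bound {k} {n} {degree (Y n) v} {classSize n (next a)} {classSize n (prev a)}
      (classSize-upper n (next-< a)) (classSize-upper n (prev-< a<k)) n≤classes+degree
    where
    open ≤-Reasoning
    a = class v
    a<k = m%n<n (toℕ v) k
    n≤classes+degree : n ≤ classSize n (next a) + classSize n (prev a) + (degree (Y n) v + 1)
    n≤classes+degree = begin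
      n                                                               ≡⟨ count-not n (λ y → cycleAdj a (y % k)) ⟨
      count n (λ y → cycleAdj a (y % k)) + count n (λ y → not (cycleAdj a (y % k)))
        ≤⟨ +-monoʳ-≤ _ (count-delete-≤ n (toℕ v) _) ⟩
      count n (λ y → cycleAdj a (y % k)) + (count n (λ y → not (toℕ v ≡ᵇ y) ∧ not (cycleAdj a (y % k))) + 1)
        ≡⟨ cong₂ _+_ (count-cycleAdj 3≤k n a<k) (cong (_+ 1) (sym (Y.degree≡count v))) ⟩
      classSize n (next a) + classSize n (prev a) + (degree (Y n) v + 1) ∎

  X-connected : ∀ m → Connected (X (suc m))
  X-connected m = connected-if-consecutive (X (suc m)) λ i →
    X.edge (λ eq → 1+n≢n (sym (trans (sym (toℕ-inject₁ i)) eq)))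
      (subst₂ (λ a b → T (cycleClose a b)) (cong (_% k) (sym (toℕ-inject₁ i))) (next-% (toℕ i))
        (cycleClose-next (toℕ i % k)))

-- Only the classes 1 and k − 1 are adjacent to the class of vertex 0; their
-- vertices are reached through vertex 3 and vertex 2 respectively.  Writing
-- k = 5 + j makes the residues of 0, …, 4 compute, which is where k ≥ 5 is used.
Y-connected : ∀ j m → Connected (Construction.Y (5 + j) (4 + m))
Y-connected j m = connected-from (Y n) zero reach
  where
  k = 5 + j
  n = 4 + m
  open Residues k
  open Construction k
  two three : Fin n
  two   = suc (suc zero)
  three = suc (suc (suc zero))

  via-three : ∀ v → class v ≡ 1 → Star (Edge (Y n)) zero v
  via-three v class≡1 = _◅_ {j = three} (Y.edge {n} {zero} {three} (λ ()) tt) (Y.edge three≢v three-far-v ◅ ε)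
    where
    three≢v : 3 ≢ toℕ v
    three≢v 3≡v with trans (cong (_% k) 3≡v) class≡1
    ... | ()
    three-far-v : T (not (cycleAdj 3 (class v)))
    three-far-v = subst (λ c → T (not (cycleAdj 3 c))) (sym class≡1) tt

  via-two : ∀ v → class v ≡ 4 + j → Star (Edge (Y n)) zero v
  via-two v class≡K = _◅_ {j = two} (Y.edge {n} {zero} {two} (λ ()) tt) (Y.edge two≢v two-far-v ◅ ε)
    where
    two≢v : 2 ≢ toℕ v
    two≢v 2≡v with trans (cong (_% k) 2≡v) class≡K
    ... | ()
    two-far-v : T (not (cycleAdj 2 (class v)))
    two-far-v = subst (λ c → T (not (cycleAdj 2 c))) (sym class≡K)
      (subst (λ r → T (not (2 ≡ᵇ r))) (sym (n%n≡0 k)) tt)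

  reach : ∀ v → Star (Edge (Y n)) zero v
  reach v with toℕ v ≟ 0
  ... | yes v≡0 = subst (Star (Edge (Y n)) zero) (toℕ-injective (sym v≡0)) ε
  ... | no  v≢0 with cycleAdj 0 (class v) in adj
  ...   | false = Y.edge (v≢0 ∘ sym) (subst (T ∘ not) (sym adj) tt) ◅ ε
  ...   | true with Equivalence.to T-∨ (subst T (sym adj) tt)
  ...     | inj₁ next0≡ = via-three v (sym (≡ᵇ⇒≡ 1 _ next0≡))
  ...     | inj₂ 0≡next =
    via-two v (trans (sym (prev-next (m%n<n (toℕ v) k))) (cong prev (sym (≡ᵇ⇒≡ 0 (next (class v)) 0≡next))))

proposition1p6 : ∀ (n k : ℕ) → 5 ≤ k → k ≤ n →
    Σ (SimpleGraph n) λ X → Σ (SimpleGraph n) λ Y →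
      Connected X × Connected Y ×
      (∀ v → 3 * n ≤ k * degree X v + 4 * k) ×
      (∀ v → (k ∸ 2) * n ≤ k * degree Y v + 3 * k) ×
      ¬ FSConnected X Y
proposition1p6 n k 5≤k k≤n with m≤n⇒∃[o]m+o≡n 5≤k | m≤n⇒∃[o]m+o≡n (≤-trans 5≤k k≤n)
... | j , refl | m , refl =
  X (5 + m) , Y (5 + m) , X-connected (4 + m) , Y-connected j (1 + m) ,
  X-degree 3≤k (5 + m) , Y-degree 3≤k (5 + m) , ¬FSConnected-XY 2≤k (3 + m)
  where
  open Construction (5 + j)
  2≤k : 2 ≤ 5 + j
  2≤k = s≤s (s≤s z≤n)
  3≤k : 3 ≤ 5 + j
  3≤k = s≤s (s≤s (s≤s z≤n))
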